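{- Let $\omega$ be a permutation and let $T$ be a standard tower tableau whose reading word is a reduced word of $\omega$. Then the set of cells of the Rothification $R_T$ is exactly the Rothe diagram $D_\omega$.
   Context: Permutations are written in one-line notation $\omega=\omega_1\omega_2\cdots\omega_n$; $s_a$ is the adjacent transposition $(a,a+1)$, and $\omega s_a$ is obtained by swapping the entries in positions $a,a+1$. A reduced word of $\omega$ is a word $\alpha_1\cdots\alpha_l$ with $\omega=s_{\alpha_1}\cdots s_{\alpha_l}$ and $l$ equal to the length (number of inversions) of $\omega$. A tower diagram is a finite sequence $(\mathcal T_1,\mathcal T_2,\ldots)$ of towers; the $i$-th tower of size $k_i\ge0$ consists of the cells $(i,0),\ldots,(i,k_i-1)$, the cell $(i,j)$ being the unit square $[i-1,i]\times[j,j+1]$ identified with its south-east corner and lying on the diagonal $x+y=i+j$; $i$ is the tower index of the cell. Sliding. For a positive integer $a$ and a tail $(\mathcal T_p,\ldots)$ of a tower diagram, $a^{\searrow}(\mathcal T_p,\ldots)$ either adds one cell or terminates: (S1) if no tower $\mathcal T_t$, $t\ge p$, has a cell on $x+y=a-1$: (a) if none has a cell on $x+y=a$, add $(a,0)$; (b) if $(a,0)\in\mathcal T_a$, $(a,1)\notin\mathcal T_a$, terminate; (c) if $(a,0),(a,1)\in\mathcal T_a$, result is $(a+1)^{\searrow}(\mathcal T_{a+1},\ldots)$. (S2) Otherwise, with $\mathcal T_i$ ($i\ge p$) the leftmost tower having a cell $(i,a-1-i)$ on $x+y=a-1$: (a) if $(i,a-i)\notin\mathcal T_i$, add it; (b)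 if $(i,a-i)\in\mathcal T_i$, $(i,a-i+1)\notin\mathcal T_i$, terminate; (c) if both are in $\mathcal T_i$, result is $(a+1)^{\searrow}(\mathcal T_{i+1},\ldots)$. Sliding $a$ into $\mathcal T$ is $a^{\searrow}(\mathcal T_1,\ldots)$. Sliding a word $\alpha_1\cdots\alpha_l$ letter by letter into the empty diagram (no step terminating), labelling the cell created by the $k$-th letter with $k$, gives the standard tower tableau of the word, whose reading word is the word; this succeeds exactly for reduced words. Rothe diagram: $D_\omega=\{(i,\omega_j): i<j,\ \omega_i>\omega_j\}$, where $(r,c)$ denotes the cell in row $r$ (rows numbered top to bottom) and column $c$. Rothification: let $T$ be a standard tower tableau with reading word $\alpha=\alpha_1\cdots\alpha_l$ and let $T'$ be the standard tower tableau of the reversed word $\alpha_l\cdots\alpha_1$. For $1\le r\le l$ let $u_r$ be the cell of $T$ labelled $r$ and $v_r$ the cell of $T'$ labelled $l+1-r$. The Rothification $R_T$ is the labelling that puts label $r$ on the cell in row (tower index of $v_r$) and column (tower index of $u_r$), for $r=1,\ldots,l$. (Equivalently, in the paper, $T'$ is reflected in the line $x+y=0$ to the virtual tableau $T^-$, and $R_T$ places the label of $u\in T$ at the intersection of the vertical shadow of $u$ with the horizontal shadow of the cell of $T^-$ whose label sums with it to $l+1$.) -}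

module Defs where

open import Data.Nat using (ℕ; zero; suc; _+_; _≤_; _<_; _<?_)
open import Data.Nat.Properties using ()
open import Data.Fin using (Fin; toℕ)
open import Data.List using (List; []; _∷_; _++_; [_]; length; filter; foldl; map; zip; reverse; lookup; upTo)
open import Data.List.Relation.Unary.All using (All)
open import Data.List.Membership.Propositional using (_∈_; _∉_)
open import Data.Product using (Σ; _×_; _,_; proj₁)
open import Relation.Binary.PropositionalEquality using (_≡_; _≢_)

idPerm : ℕ → List ℕ
idPerm n = map suc (upTo n)

-- swapPos a ω = ω s_a : swap the entries in positions a, a+1 (1-based)
swapPos : ℕ → List ℕ → List ℕ
swapPos (suc zero) (x ∷ y ∷ xs) = y ∷ x ∷ xs
swapPos (suc (suc k)) (x ∷ xs) = x ∷ swapPos (suc k) xs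
swapPos _ xs = xs

-- s_{α₁} ⋯ s_{αₗ} ∈ S_n in one-line notation
--   = (⋯((id s_{α₁}) s_{α₂}) ⋯) s_{αₗ}
wordPerm : ℕ → List ℕ → List ℕ
wordPerm n α = foldl (λ w a → swapPos a w) (idPerm n) α

-- number of inversions (= Coxeter length)
inversions : List ℕ → ℕ
inversions [] = 0
inversions (x ∷ xs) = length (filter (_<? x) xs) + inversions xs

ReducedWord : ℕ → List ℕ → List ℕ → Set
ReducedWord n ω α =
  All (λ a → 1 ≤ a × a < n) α × ω ≡ wordPerm n α × length α ≡ inversions ω

InRothe : List ℕ → ℕ × ℕ → Set
InRothe ω (r , c) =
  Σ (Fin (length ω)) λ i → Σ (Fin (length ω)) λ j →
    toℕ i < toℕ j × lookup ω j < lookup ω i ×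
    r ≡ suc (toℕ i) × c ≡ lookup ω j

-- Tower diagrams, as the list of their cells (i , j)  (tower i, height j)

Cell : Set
Cell = ℕ × ℕ

NoCellOnDiag : List Cell → ℕ → ℕ → Set
NoCellOnDiag D p d = ∀ t j → (t , j) ∈ D → p ≤ t → t + j ≢ d

-- no tower T_t with t ≥ p has a cell on the diagonal x + y = a - 1
-- (a ≥ 1; written as suc (t + j) ≢ a to avoid truncated subtraction)
NoCellOnPrevDiag : List Cell → ℕ → ℕ → Set
NoCellOnPrevDiag D p a = ∀ t j → (t , j) ∈ D → p ≤ t → suc (t + j) ≢ a

LeftmostOnPrevDiag : List Cell → ℕ → ℕ → ℕ → ℕ → Set
LeftmostOnPrevDiag D p a i j =
  (i , j) ∈ D × p ≤ i × suc (i + j) ≡ a ×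
  (∀ t k → (t , k) ∈ D → p ≤ t → suc (t + k) ≡ a → i ≤ t)

-- Slide D a p c :  a↘(T_p, …) (for the tower diagram with cell set D)
-- adds the cell c.  The terminating cases (S1b), (S2b) have no constructor.
data Slide (D : List Cell) : ℕ → ℕ → Cell → Set where
  s1a : ∀ {a p} →
        NoCellOnPrevDiag D p a →
        NoCellOnDiag D p a →
        Slide D a p (a , 0)
  s1c : ∀ {a p c} →
        NoCellOnPrevDiag D p a →
        (a , 0) ∈ D → (a , 1) ∈ D →
        Slide D (suc a) (suc a) c →
        Slide D a p c
  s2a : ∀ {a p i j} →
        LeftmostOnPrevDiag D p a i j →
        (i , suc j) ∉ D →
        Slide D a p (i , suc j)
  s2c : ∀ {a p i j c} →
        LeftmostOnPrevDiag D p a i j →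
        (i , suc j) ∈ D → (i , suc (suc j)) ∈ D →
        Slide D (suc a) (suc i) c →
        Slide D a p c

-- SlideWord D w E : sliding the word w letter by letter into the diagram
-- with cell list D succeeds (no step terminates) and yields the cell list E;
-- new cells are appended, so the k-th entry of E is the cell labelled k.
data SlideWord : List Cell → List ℕ → List Cell → Set where
  done : ∀ {D} → SlideWord D [] D
  step : ∀ {D a w c E} →
         Slide D a 1 c →
         SlideWord (D ++ [ c ]) w E →
         SlideWord D (a ∷ w) E

StdTowerTableau : List ℕ → List Cell → Set
StdTowerTableau w T = SlideWord [] w T

towerIndex : Cell → ℕ
towerIndex = proj₁

-- Given T (tableau of α) and T' (tableau of the reversed word), the
-- Rothification R_T as the list of its cells in label order: label r
-- sits in row = towerIndex v_r, column = towerIndex u_r, where u_r is the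
-- cell of T labelled r and v_r is the cell of T' labelled l + 1 - r.
rothification : List Cell → List Cell → List Cell
rothification T T' = zip (map towerIndex (reverse T')) (map towerIndex T)

-- For a permutation w, tower t of its tower diagram has as many cells as there
-- are larger entries preceding t. If positions a, a + 1 of w hold an ascent
-- x < y, sliding the letter a into this diagram adds exactly the cell on top of
-- tower x: the sliding cell passes over the towers of the smaller entries left
-- of x, which end below its diagonal, climbs along those right of y, which
-- straddle it, and comes to rest on tower x. A reduced word consists of
-- ascents only, so the k-th cell of T lies in tower v_k, where (u_k , v_k) is
-- the pair exchanged by the k-th letter, and these pairs are exactly the
-- inversions of ω. Relabelling every entry by its position in ω turns the
-- reversed word into a reduced word of ω⁻¹ that exchanges positions; hence the
-- cell of T' labelled l + 1 - k lies in tower pos_ω(u_k), and R_T consists of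
-- the cells (pos_ω(u) , v) of the inversions (u , v): the Rothe diagram.

module Submission where

open import Defs
open import Data.Nat
open import Data.Nat.Properties
open import Algebra.Properties.CommutativeSemigroup +-commutativeSemigroup using (x∙yz≈y∙xz)
open import Data.List using (List; []; _∷_; _++_; [_]; length; filter; foldl; map; zip; reverse; lookup)
open import Data.List.Properties using (map-upTo; length-map; map-++; foldl-++; length-++; ++-assoc; ++-identityʳ; filter-accept; filter-reject; unfold-reverse; reverse-map; reverse-involutive; map-cong-local; map-∘)
open import Data.List.Membership.Propositional using (_∈_; _∉_)
open import Data.List.Membership.Propositional.Properties using (∈-map⁺; ∈-map⁻; ∈-++⁻; ∈-++⁺ˡ; ∈-++⁺ʳ; ∈-∃++; ∈-lookup)
open import Data.List.Relation.Unary.Any using (here; there; index; any?; tail)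
open import Data.List.Relation.Unary.Any.Properties using (lookup-index)
open import Data.List.Relation.Unary.All using (All; []; _∷_)
open import Data.List.Relation.Binary.Permutation.Propositional using (_↭_; ↭-sym; ↭-refl; prep; swap)
import Data.List.Relation.Binary.Permutation.Propositional as ↭
open import Data.List.Relation.Binary.Permutation.Propositional.Properties using (∈-resp-↭; ↭-length; ++⁺ˡ)
open import Data.Product using (_×_; _,_; proj₁; proj₂; ∃₂)
open import Data.Sum using (_⊎_; inj₁; inj₂; [_,_]′)
open import Data.Empty using (⊥-elim)
open import Data.Unit using (⊤; tt)
open import Relation.Nullary using (Dec; yes; no; ¬_)
open import Relation.Binary.PropositionalEquality hiding ([_])
open import Data.Nat.Tactic.RingSolver using (solve-∀)
open import Data.Fin using (Fin; toℕ) renaming (zero to fzero; suc to fsuc)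
open import Function using (_∘_; id)
open import Function.Bundles using (_⇔_; mk⇔; Equivalence)
open import Function.Properties.Equivalence using () renaming (trans to ⇔-trans)

applySwap : List ℕ → ℕ → List ℕ
applySwap w a = swapPos a w

applySwaps : List ℕ → List ℕ → List ℕ
applySwaps = foldl applySwap

-- 1-based lookup; position 0 and positions past the end read as 0
entryAt : List ℕ → ℕ → ℕ
entryAt [] _ = 0
entryAt (v ∷ w) zero = 0
entryAt (v ∷ w) (suc zero) = v
entryAt (v ∷ w) (suc (suc k)) = entryAt w (suc k)

swapPos-involutive : ∀ a w → swapPos a (swapPos a w) ≡ w
swapPos-involutive zero w = refl
swapPos-involutive (suc zero) [] = refl
swapPos-involutive (suc zero) (x ∷ []) = refl
swapPos-involutive (suc zero) (x ∷ y ∷ w) = refl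
swapPos-involutive (suc (suc k)) [] = refl
swapPos-involutive (suc (suc k)) (x ∷ w) = cong (x ∷_) (swapPos-involutive (suc k) w)

swapPos-↭ : ∀ a w → swapPos a w ↭ w
swapPos-↭ zero w = ↭-refl
swapPos-↭ (suc zero) [] = ↭-refl
swapPos-↭ (suc zero) (x ∷ []) = ↭-refl
swapPos-↭ (suc zero) (x ∷ y ∷ w) = swap y x ↭-refl
swapPos-↭ (suc (suc k)) [] = ↭-refl
swapPos-↭ (suc (suc k)) (x ∷ w) = prep x (swapPos-↭ (suc k) w)

swapPos-map : ∀ (f : ℕ → ℕ) a w → swapPos a (map f w) ≡ map f (swapPos a w)
swapPos-map f zero w = refl
swapPos-map f (suc zero) [] = refl
swapPos-map f (suc zero) (x ∷ []) = refl
swapPos-map f (suc zero) (x ∷ y ∷ w) = refl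
swapPos-map f (suc (suc k)) [] = refl
swapPos-map f (suc (suc k)) (x ∷ w) = cong (f x ∷_) (swapPos-map f (suc k) w)

applySwaps-map : ∀ (f : ℕ → ℕ) w β → applySwaps (map f w) β ≡ map f (applySwaps w β)
applySwaps-map f w [] = refl
applySwaps-map f w (a ∷ β) =
  trans (cong (λ z → applySwaps z β) (swapPos-map f a w)) (applySwaps-map f (swapPos a w) β)

applySwaps-reverse : ∀ w β → applySwaps (applySwaps w β) (reverse β) ≡ w
applySwaps-reverse w [] = refl
applySwaps-reverse w (a ∷ β) = begin
    applySwaps (applySwaps (swapPos a w) β) (reverse (a ∷ β))
  ≡⟨ cong (applySwaps _) (unfold-reverse a β) ⟩
    applySwaps (applySwaps (swapPos a w) β) (reverse β ++ [ a ])
  ≡⟨ foldl-++ applySwap _ (reverse β) [ a ] ⟩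
    swapPos a (applySwaps (applySwaps (swapPos a w) β) (reverse β))
  ≡⟨ cong (swapPos a) (applySwaps-reverse (swapPos a w) β) ⟩
    swapPos a (swapPos a w)
  ≡⟨ swapPos-involutive a w ⟩
    w ∎
  where open ≡-Reasoning

data AscentSplit (w : List ℕ) (a : ℕ) : Set where
  ascentSplit : ∀ L x y R → w ≡ L ++ x ∷ y ∷ R → suc (length L) ≡ a →
                entryAt w a ≡ x → entryAt w (suc a) ≡ y →
                swapPos a w ≡ L ++ y ∷ x ∷ R → AscentSplit w a

ascentSplit? : ∀ a w → 1 ≤ a → entryAt w a < entryAt w (suc a) → AscentSplit w a
ascentSplit? (suc zero) (x ∷ y ∷ R) _ _ = ascentSplit [] x y R refl refl refl refl refl
ascentSplit? (suc (suc k)) (v ∷ w) _ lt with ascentSplit? (suc k) w (s≤s z≤n) lt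
... | ascentSplit L x y R e₁ e₂ e₃ e₄ e₅ =
  ascentSplit (v ∷ L) x y R (cong (v ∷_) e₁) (cong suc e₂) e₃ e₄ (cong (v ∷_) e₅)
ascentSplit? (suc zero) [] _ ()
ascentSplit? (suc zero) (x ∷ []) _ ()
ascentSplit? (suc (suc k)) [] _ ()

entryAt-++ˡ : ∀ L u v R → entryAt (L ++ u ∷ v ∷ R) (suc (length L)) ≡ u
entryAt-++ˡ [] u v R = refl
entryAt-++ˡ (z ∷ []) u v R = refl
entryAt-++ˡ (z ∷ z' ∷ L) u v R = entryAt-++ˡ (z' ∷ L) u v R

entryAt-++ʳ : ∀ L u v R → entryAt (L ++ u ∷ v ∷ R) (suc (suc (length L))) ≡ v
entryAt-++ʳ [] u v R = refl
entryAt-++ʳ (z ∷ L) u v R = entryAt-++ʳ L u v R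

indicator : ∀ {p} {P : Set p} → Dec P → ℕ
indicator (yes _) = 1
indicator (no _) = 0

indicator-yes : ∀ {p} {P : Set p} (d : Dec P) → P → indicator d ≡ 1
indicator-yes (yes _) _ = refl
indicator-yes (no ¬p) p = ⊥-elim (¬p p)

indicator-no : ∀ {p} {P : Set p} (d : Dec P) → ¬ P → indicator d ≡ 0
indicator-no (yes p) ¬p = ⊥-elim (¬p p)
indicator-no (no _) _ = refl

countBelow : ℕ → List ℕ → ℕ
countBelow t [] = 0
countBelow t (v ∷ w) = indicator (v <? t) + countBelow t w

countAbove : ℕ → List ℕ → ℕ
countAbove t [] = 0
countAbove t (v ∷ w) = indicator (t <? v) + countAbove t w

countBelow-++ : ∀ t L M → countBelow t (L ++ M) ≡ countBelow t L + countBelow t M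
countBelow-++ t [] M = refl
countBelow-++ t (v ∷ L) M =
  trans (cong (indicator (v <? t) +_) (countBelow-++ t L M)) (sym (+-assoc (indicator (v <? t)) _ _))

countBelow+countAbove : ∀ t L → t ∉ L → countBelow t L + countAbove t L ≡ length L
countBelow+countAbove t [] _ = refl
countBelow+countAbove t (v ∷ L) t∉ with v <? t | t <? v
... | yes p | yes q = ⊥-elim (<-asym p q)
... | yes _ | no _ = cong suc (countBelow+countAbove t L (t∉ ∘ there))
... | no _ | yes _ =
  trans (+-suc (countBelow t L) (countAbove t L)) (cong suc (countBelow+countAbove t L (t∉ ∘ there)))
... | no p | no q = ⊥-elim (t∉ (here (sym (≤-antisym (≮⇒≥ q) (≮⇒≥ p)))))

countBelow≤length : ∀ t L → countBelow t L ≤ length L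
countBelow≤length t [] = z≤n
countBelow≤length t (v ∷ L) with v <? t
... | yes _ = s≤s (countBelow≤length t L)
... | no _ = m≤n⇒m≤1+n (countBelow≤length t L)

countBelow-lowerBound : ∀ t L → (∀ v → v ∈ L → t ≤ v) → countBelow t L ≡ 0
countBelow-lowerBound t [] _ = refl
countBelow-lowerBound t (v ∷ L) bound =
  cong₂ _+_ (indicator-no (v <? t) (≤⇒≯ (bound v (here refl))))
            (countBelow-lowerBound t L (λ u → bound u ∘ there))

countBelow-↭ : ∀ t {xs ys} → xs ↭ ys → countBelow t xs ≡ countBelow t ys
countBelow-↭ t ↭.refl = refl
countBelow-↭ t (prep x p) = cong (indicator (x <? t) +_) (countBelow-↭ t p)
countBelow-↭ t (swap {xs} x y p) = begin
    indicator (x <? t) + (indicator (y <? t) + countBelow t xs)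
  ≡⟨ x∙yz≈y∙xz (indicator (x <? t)) (indicator (y <? t)) (countBelow t xs) ⟩
    indicator (y <? t) + (indicator (x <? t) + countBelow t xs)
  ≡⟨ cong (λ z → indicator (y <? t) + (indicator (x <? t) + z)) (countBelow-↭ t p) ⟩
    _ ∎
  where open ≡-Reasoning
countBelow-↭ t (↭.trans p q) = trans (countBelow-↭ t p) (countBelow-↭ t q)

countBelow-suc-∉ : ∀ t R → t ∉ R → countBelow (suc t) R ≡ countBelow t R
countBelow-suc-∉ t [] _ = refl
countBelow-suc-∉ t (v ∷ R) t∉ with v <? suc t | v <? t
... | yes _ | yes _ = cong suc (countBelow-suc-∉ t R (t∉ ∘ there))
... | no _ | no _ = countBelow-suc-∉ t R (t∉ ∘ there)
... | no p | yes q = ⊥-elim (p (m≤n⇒m≤1+n q))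
... | yes p | no q = ⊥-elim (t∉ (here (≤-antisym (≮⇒≥ q) (s≤s⁻¹ p))))

Nodup : List ℕ → Set
Nodup [] = ⊤
Nodup (v ∷ w) = v ∉ w × Nodup w

countBelow-suc-∈ : ∀ t R → Nodup R → t ∈ R → countBelow (suc t) R ≡ suc (countBelow t R)
countBelow-suc-∈ t (v ∷ R) (v∉ , _) (here refl) =
  trans (cong₂ _+_ (indicator-yes (v <? suc v) ≤-refl) (countBelow-suc-∉ v R v∉))
        (cong suc (sym (cong (_+ countBelow v R) (indicator-no (v <? v) (<-irrefl refl)))))
countBelow-suc-∈ t (v ∷ R) (v∉ , nd) (there m) with v <? suc t | v <? t
... | yes _ | yes _ = cong suc (countBelow-suc-∈ t R nd m)
... | no _ | no _ = countBelow-suc-∈ t R nd m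
... | no p | yes q = ⊥-elim (p (m≤n⇒m≤1+n q))
... | yes p | no q = ⊥-elim (v∉ (subst (_∈ R) (sym (≤-antisym (s≤s⁻¹ p) (≮⇒≥ q))) m))

Nodup-↭ : ∀ {xs ys} → xs ↭ ys → Nodup xs → Nodup ys
Nodup-↭ ↭.refl nd = nd
Nodup-↭ (prep x p) (x∉ , nd) = x∉ ∘ ∈-resp-↭ (↭-sym p) , Nodup-↭ p nd
Nodup-↭ (swap x y p) (x∉ , y∉ , nd) =
  (λ { (here e) → x∉ (here (sym e)) ; (there m) → y∉ (∈-resp-↭ (↭-sym p) m) }) ,
  x∉ ∘ there ∘ ∈-resp-↭ (↭-sym p) , Nodup-↭ p nd
Nodup-↭ (↭.trans p q) nd = Nodup-↭ q (Nodup-↭ p nd)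

Nodup-++⁻ʳ : ∀ L M → Nodup (L ++ M) → Nodup M
Nodup-++⁻ʳ [] M nd = nd
Nodup-++⁻ʳ (v ∷ L) M (_ , nd) = Nodup-++⁻ʳ L M nd

Nodup-++-∉ˡ : ∀ L v M → Nodup (L ++ v ∷ M) → v ∉ L
Nodup-++-∉ˡ (u ∷ L) v M (u∉ , _) (here refl) = u∉ (∈-++⁺ʳ L (here refl))
Nodup-++-∉ˡ (u ∷ L) v M (_ , nd) (there m) = Nodup-++-∉ˡ L v M nd m

Nodup-++-disjoint : ∀ L M v → Nodup (L ++ M) → v ∈ L → v ∉ M
Nodup-++-disjoint (u ∷ L) M v (u∉ , _) (here refl) m = u∉ (∈-++⁺ʳ L m)
Nodup-++-disjoint (u ∷ L) M v (_ , nd) (there m') m = Nodup-++-disjoint L M v nd m' m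

Nodup-map-suc : ∀ w → Nodup w → Nodup (map suc w)
Nodup-map-suc [] _ = tt
Nodup-map-suc (v ∷ w) (v∉ , nd) = v∉ ∘ unsuc , Nodup-map-suc w nd
  where
  unsuc : suc v ∈ map suc w → v ∈ w
  unsuc m with ∈-map⁻ suc m
  ... | u , u∈ , refl = u∈

record IsPermutation (n : ℕ) (w : List ℕ) : Set where
  field
    size : length w ≡ n
    nodup : Nodup w
    bounds : ∀ v → v ∈ w → 1 ≤ v × v ≤ n
    complete : ∀ t → 1 ≤ t → t ≤ n → t ∈ w
    countBelow≡pred : ∀ t → 1 ≤ t → t ≤ n → countBelow t w ≡ pred t
open IsPermutation

IsPermutation-↭ : ∀ {n w w'} → w' ↭ w → IsPermutation n w → IsPermutation n w'
IsPermutation-↭ p I = record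
  { size = trans (↭-length p) (size I)
  ; nodup = Nodup-↭ (↭-sym p) (nodup I)
  ; bounds = λ v → bounds I v ∘ ∈-resp-↭ p
  ; complete = λ t a b → ∈-resp-↭ (↭-sym p) (complete I t a b)
  ; countBelow≡pred = λ t a b → trans (countBelow-↭ t p) (countBelow≡pred I t a b) }

IsPermutation-applySwaps : ∀ {n} w β → IsPermutation n w → IsPermutation n (applySwaps w β)
IsPermutation-applySwaps w [] I = I
IsPermutation-applySwaps w (a ∷ β) I =
  IsPermutation-applySwaps (swapPos a w) β (IsPermutation-↭ (swapPos-↭ a w) I)

idPerm-suc : ∀ n → idPerm (suc n) ≡ 1 ∷ map suc (idPerm n)
idPerm-suc n = cong (λ z → 1 ∷ map suc z) (sym (map-upTo suc n))

countBelow-zero : ∀ w → countBelow 0 w ≡ 0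
countBelow-zero [] = refl
countBelow-zero (v ∷ w) = countBelow-zero w

countBelow-map-suc : ∀ t w → countBelow (suc t) (map suc w) ≡ countBelow t w
countBelow-map-suc t [] = refl
countBelow-map-suc t (v ∷ w) with suc v <? suc t | v <? t
... | yes _ | yes _ = cong suc (countBelow-map-suc t w)
... | no _ | no _ = countBelow-map-suc t w
... | yes p | no q = ⊥-elim (q (s≤s⁻¹ p))
... | no p | yes q = ⊥-elim (p (s≤s q))

idPerm-isPermutation : ∀ n → IsPermutation n (idPerm n)
idPerm-isPermutation zero = record
  { size = refl ; nodup = tt ; bounds = λ _ ()
  ; complete = λ _ a b → ⊥-elim (<⇒≱ a b) ; countBelow≡pred = λ _ a b → ⊥-elim (<⇒≱ a b) }
idPerm-isPermutation (suc n) rewrite idPerm-suc n = record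
  { size = cong suc (trans (length-map suc (idPerm n)) (size I))
  ; nodup = 1∉ , Nodup-map-suc (idPerm n) (nodup I)
  ; bounds = bounded
  ; complete = covers
  ; countBelow≡pred = counts }
  where
  I = idPerm-isPermutation n
  1∉ : 1 ∉ map suc (idPerm n)
  1∉ m with ∈-map⁻ suc m
  ... | u , u∈ , e = <-irrefl (suc-injective e) (proj₁ (bounds I u u∈))
  bounded : ∀ v → v ∈ 1 ∷ map suc (idPerm n) → 1 ≤ v × v ≤ suc n
  bounded v (here refl) = s≤s z≤n , s≤s z≤n
  bounded v (there m) with ∈-map⁻ suc m
  ... | u , u∈ , refl = s≤s z≤n , s≤s (proj₂ (bounds I u u∈))
  covers : ∀ t → 1 ≤ t → t ≤ suc n → t ∈ 1 ∷ map suc (idPerm n)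
  covers (suc zero) _ _ = here refl
  covers (suc (suc t)) _ (s≤s t<n) = there (∈-map⁺ suc (complete I (suc t) (s≤s z≤n) t<n))
  counts : ∀ t → 1 ≤ t → t ≤ suc n → countBelow t (1 ∷ map suc (idPerm n)) ≡ pred t
  counts (suc zero) _ _ = trans (countBelow-map-suc 0 (idPerm n)) (countBelow-zero (idPerm n))
  counts (suc (suc t)) _ (s≤s t<n) =
    cong suc (trans (countBelow-map-suc (suc t) (idPerm n)) (countBelow≡pred I (suc t) (s≤s z≤n) t<n))

-- the number of entries of w that exceed t and precede it: the height of
-- tower t in the tower diagram of w
height : List ℕ → ℕ → ℕ
height [] t = 0
height (v ∷ w) t with v ≟ t
... | yes _ = 0
... | no _ = indicator (t <? v) + height w t

InDiagram : List ℕ → Cell → Set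
InDiagram w (t , j) = t ∈ w × j < height w t

DiagramOf : List ℕ → List Cell → Set
DiagramOf w D = ∀ c → c ∈ D ⇔ InDiagram w c

height-head : ∀ t M → height (t ∷ M) t ≡ 0
height-head t M with t ≟ t
... | yes _ = refl
... | no t≢t = ⊥-elim (t≢t refl)

height-cons-≢ : ∀ t v M → v ≢ t → height (v ∷ M) t ≡ indicator (t <? v) + height M t
height-cons-≢ t v M v≢t with v ≟ t
... | yes v≡t = ⊥-elim (v≢t v≡t)
... | no _ = refl

height-++-∈ : ∀ t L M → t ∈ L → height (L ++ M) t ≡ height L t
height-++-∈ t (v ∷ L) M m with v ≟ t
... | yes _ = refl
height-++-∈ t (v ∷ L) M (here e) | no v≢t = ⊥-elim (v≢t (sym e))
height-++-∈ t (v ∷ L) M (there m) | no _ = cong (indicator (t <? v) +_) (height-++-∈ t L M m)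

height-++-∉ : ∀ t L M → t ∉ L → height (L ++ M) t ≡ countAbove t L + height M t
height-++-∉ t [] M _ = refl
height-++-∉ t (v ∷ L) M t∉ with v ≟ t
... | yes e = ⊥-elim (t∉ (here (sym e)))
... | no _ = trans (cong (indicator (t <? v) +_) (height-++-∉ t L M (t∉ ∘ there)))
                   (sym (+-assoc (indicator (t <? v)) _ _))

height-map-suc : ∀ w t → height (map suc w) (suc t) ≡ height w t
height-map-suc [] t = refl
height-map-suc (v ∷ w) t with suc v ≟ suc t | v ≟ t
... | yes _ | yes _ = refl
... | yes e | no ne = ⊥-elim (ne (suc-injective e))
... | no ne | yes e = ⊥-elim (ne (cong suc e))
... | no _ | no _ with suc t <? suc v | t <? v
... | yes _ | yes _ = cong suc (height-map-suc w t)
... | no _ | no _ = height-map-suc w t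
... | yes p | no q = ⊥-elim (q (s≤s⁻¹ p))
... | no p | yes q = ⊥-elim (p (s≤s q))

idPerm-∌0 : ∀ n → 0 ∉ idPerm n
idPerm-∌0 n m with bounds (idPerm-isPermutation n) 0 m
... | () , _

height-idPerm : ∀ n t → t ∈ idPerm n → height (idPerm n) t ≡ 0
height-idPerm zero t ()
height-idPerm (suc n) t = subst (λ w → t ∈ w → height w t ≡ 0) (sym (idPerm-suc n)) go
  where
  go : t ∈ 1 ∷ map suc (idPerm n) → height (1 ∷ map suc (idPerm n)) t ≡ 0
  go (here refl) = height-head 1 (map suc (idPerm n))
  go (there m) with ∈-map⁻ suc m
  ... | u , u∈ , refl = begin
      height (1 ∷ map suc (idPerm n)) (suc u)
    ≡⟨ height-cons-≢ (suc u) 1 _ (λ e → idPerm-∌0 n (subst (_∈ idPerm n) (sym (suc-injective e)) u∈)) ⟩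
      indicator (suc u <? 1) + height (map suc (idPerm n)) (suc u)
    ≡⟨ cong (indicator (suc u <? 1) +_) (trans (height-map-suc (idPerm n) u) (height-idPerm n u u∈)) ⟩
      indicator (suc u <? 1) + 0
    ≡⟨ cong (_+ 0) (indicator-no (suc u <? 1) λ { (s≤s ()) }) ⟩
      0 ∎
    where open ≡-Reasoning

height-swap-smaller : ∀ L x y R → x < y → Nodup (L ++ x ∷ y ∷ R) →
                      height (L ++ y ∷ x ∷ R) x ≡ suc (height (L ++ x ∷ y ∷ R) x)
height-swap-smaller L x y R x<y nd = begin
    height (L ++ y ∷ x ∷ R) x
  ≡⟨ height-++-∉ x L (y ∷ x ∷ R) x∉L ⟩
    countAbove x L + height (y ∷ x ∷ R) x
  ≡⟨ cong (countAbove x L +_) (height-cons-≢ x y (x ∷ R) (λ e → <-irrefl (sym e) x<y)) ⟩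
    countAbove x L + (indicator (x <? y) + height (x ∷ R) x)
  ≡⟨ cong (countAbove x L +_) (cong₂ _+_ (indicator-yes (x <? y) x<y) (height-head x R)) ⟩
    countAbove x L + 1
  ≡⟨ +-comm (countAbove x L) 1 ⟩
    suc (countAbove x L)
  ≡⟨ cong suc (sym (trans (height-++-∉ x L (x ∷ y ∷ R) x∉L)
                          (trans (cong (countAbove x L +_) (height-head x (y ∷ R))) (+-identityʳ _)))) ⟩
    suc (height (L ++ x ∷ y ∷ R) x) ∎
  where
  open ≡-Reasoning
  x∉L = Nodup-++-∉ˡ L x (y ∷ R) nd

height-swap-other : ∀ L x y R t → x < y → t ≢ x →
                    height (L ++ y ∷ x ∷ R) t ≡ height (L ++ x ∷ y ∷ R) t
height-swap-other L x y R t x<y t≢x with any? (t ≟_) L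
... | yes t∈L = trans (height-++-∈ t L _ t∈L) (sym (height-++-∈ t L _ t∈L))
... | no t∉L = trans (height-++-∉ t L _ t∉L)
                 (trans (cong (countAbove t L +_) middle) (sym (height-++-∉ t L _ t∉L)))
  where
  middle : height (y ∷ x ∷ R) t ≡ height (x ∷ y ∷ R) t
  middle with t ≟ y
  ... | yes refl = begin
      height (t ∷ x ∷ R) t
    ≡⟨ height-head t (x ∷ R) ⟩
      0
    ≡⟨ sym (cong₂ _+_ (indicator-no (t <? x) (λ t<x → <-asym t<x x<y)) (height-head t R)) ⟩
      indicator (t <? x) + height (t ∷ R) t
    ≡⟨ sym (height-cons-≢ t x (t ∷ R) (t≢x ∘ sym)) ⟩
      height (x ∷ t ∷ R) t ∎
    where open ≡-Reasoning
  ... | no t≢y = begin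
      height (y ∷ x ∷ R) t
    ≡⟨ height-cons-≢ t y (x ∷ R) (t≢y ∘ sym) ⟩
      indicator (t <? y) + height (x ∷ R) t
    ≡⟨ cong (indicator (t <? y) +_) (height-cons-≢ t x R (t≢x ∘ sym)) ⟩
      indicator (t <? y) + (indicator (t <? x) + height R t)
    ≡⟨ x∙yz≈y∙xz (indicator (t <? y)) (indicator (t <? x)) (height R t) ⟩
      indicator (t <? x) + (indicator (t <? y) + height R t)
    ≡⟨ cong (indicator (t <? x) +_) (sym (height-cons-≢ t y R (t≢y ∘ sym))) ⟩
      indicator (t <? x) + height (y ∷ R) t
    ≡⟨ sym (height-cons-≢ t x (y ∷ R) (t≢x ∘ sym)) ⟩
      height (x ∷ y ∷ R) t ∎
    where open ≡-Reasoning

entry≡suc-countBelow : ∀ {n w t} → IsPermutation n w → t ∈ w → t ≡ suc (countBelow t w)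
entry≡suc-countBelow {t = t} I t∈ with bounds I t t∈
... | 1≤t , t≤n =
  trans (sym (suc-pred t {{>-nonZero 1≤t}})) (cong suc (sym (countBelow≡pred I t 1≤t t≤n)))

-- t + height w t is the diagonal just above the top cell of tower t.
top-diagonal : ∀ {n w} P t Q → IsPermutation n w → w ≡ P ++ t ∷ Q →
               t + height w t ≡ suc (length P) + countBelow t Q
top-diagonal P t Q I refl = begin
    t + height (P ++ t ∷ Q) t
  ≡⟨ cong₂ _+_ (entry≡suc-countBelow I (∈-++⁺ʳ P (here refl))) (height-++-∉ t P (t ∷ Q) t∉P) ⟩
    suc (countBelow t (P ++ t ∷ Q)) + (countAbove t P + height (t ∷ Q) t)
  ≡⟨ cong₂ (λ u v → suc u + (countAbove t P + v)) (countBelow-++ t P (t ∷ Q)) (height-head t Q) ⟩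
    suc (countBelow t P + (indicator (t <? t) + countBelow t Q)) + (countAbove t P + 0)
  ≡⟨ cong (λ z → suc (countBelow t P + (z + countBelow t Q)) + (countAbove t P + 0))
          (indicator-no (t <? t) (<-irrefl refl)) ⟩
    suc (countBelow t P + countBelow t Q) + (countAbove t P + 0)
  ≡⟨ rearrange (countBelow t P) (countBelow t Q) (countAbove t P) ⟩
    suc (countBelow t P + countAbove t P) + countBelow t Q
  ≡⟨ cong (λ z → suc z + countBelow t Q) (countBelow+countAbove t P t∉P) ⟩
    suc (length P) + countBelow t Q ∎
  where
  open ≡-Reasoning
  t∉P = Nodup-++-∉ˡ P t Q (nodup I)
  rearrange : ∀ b q c → suc (b + q) + (c + 0) ≡ suc (b + c) + q
  rearrange = solve-∀

NoCellOnPrevDiagBetween : List Cell → ℕ → ℕ → ℕ → Set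
NoCellOnPrevDiagBetween D p t a = ∀ s j → (s , j) ∈ D → p ≤ s → s < t → suc (s + j) ≢ a

leftmost-≥ : ∀ {D p a i j t} → LeftmostOnPrevDiag D p a i j → NoCellOnPrevDiagBetween D p t a → t ≤ i
leftmost-≥ (ij∈ , p≤i , i+j , _) clear = ≮⇒≥ (λ i<t → clear _ _ ij∈ p≤i i<t i+j)

leftmost-unique : ∀ {D p a i j t k} → LeftmostOnPrevDiag D p a i j →
                  (t , k) ∈ D → p ≤ t → suc (t + k) ≡ a → NoCellOnPrevDiagBetween D p t a →
                  i ≡ t × j ≡ k
leftmost-unique {t = t} {k} lm@(_ , _ , i+j , leftmost) tk∈ p≤t t+k clear = i≡t , j≡k
  where
  i≡t : _ ≡ t
  i≡t = ≤-antisym (leftmost t k tk∈ p≤t t+k) (leftmost-≥ lm clear)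
  j≡k : _ ≡ k
  j≡k = +-cancelˡ-≡ t _ k (suc-injective (trans (subst (λ i → suc (i + _) ≡ _) i≡t i+j) (sym t+k)))

leftmost-absent : ∀ {D p a t i j} → a ≤ t → NoCellOnPrevDiagBetween D p t a →
                  ¬ LeftmostOnPrevDiag D p a i j
leftmost-absent {a = a} {i = i} {j} a≤t clear lm@(_ , _ , i+j , _) =
  <-irrefl refl (subst (a <_) i+j (s≤s (≤-trans (≤-trans a≤t (leftmost-≥ lm clear)) (m≤m+n i j))))

module SlideAscent {n} (L : List ℕ) (x y : ℕ) (R : List ℕ) (x<y : x < y)
                   (I : IsPermutation n (L ++ x ∷ y ∷ R))
                   (D : List Cell) (D≈ω : DiagramOf (L ++ x ∷ y ∷ R) D) where

  ω : List ℕ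
  ω = L ++ x ∷ y ∷ R

  a : ℕ
  a = suc (length L)

  -- While the sliding cell passes tower t it moves along the diagonal a + N t - 1.
  N : ℕ → ℕ
  N t = countBelow t R

  top : ℕ → ℕ
  top t = t + height ω t

  x∈ω : x ∈ ω
  x∈ω = ∈-++⁺ʳ L (here refl)

  1≤x : 1 ≤ x
  1≤x = proj₁ (bounds I x x∈ω)

  cell-in : ∀ {t j} → t ∈ ω → t + j < top t → (t , j) ∈ D
  cell-in {t} {j} t∈ lt = Equivalence.from (D≈ω (t , j)) (t∈ , +-cancelˡ-< t j _ lt)

  cell-out : ∀ {t j} → (t , j) ∈ D → t ∈ ω × t + j < top t
  cell-out {t} {j} m with Equivalence.to (D≈ω (t , j)) m
  ... | t∈ , lt = t∈ , +-monoʳ-< t lt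

  N-1 : N 1 ≡ 0
  N-1 = countBelow-lowerBound 1 R (λ v v∈ → proj₁ (bounds I v (∈-++⁺ʳ L (there (there v∈)))))

  N-suc-∈R : ∀ {t} → t ∈ R → N (suc t) ≡ suc (N t)
  N-suc-∈R = countBelow-suc-∈ _ R (proj₂ (proj₂ (Nodup-++⁻ʳ L (x ∷ y ∷ R) (nodup I))))

  N-suc-∈L : ∀ {t} → t ∈ L → N (suc t) ≡ N t
  N-suc-∈L {t} t∈L =
    countBelow-suc-∉ t R (Nodup-++-disjoint L (x ∷ y ∷ R) t (nodup I) t∈L ∘ there ∘ there)

  countBelow-xy : ∀ {t} → t < x → countBelow t (x ∷ y ∷ R) ≡ N t
  countBelow-xy {t} t<x = cong₂ _+_ (indicator-no (x <? t) (<-asym t<x))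
                                    (cong (_+ N t) (indicator-no (y <? t) (<-asym (<-trans t<x x<y))))

  top-x : top x ≡ a + N x
  top-x = trans (top-diagonal L x (y ∷ R) I refl)
                (cong (λ z → a + (z + N x)) (indicator-no (y <? x) (<-asym x<y)))

  -- A smaller tower right of y has cells on the diagonals a + N t and a + N t + 1 …
  tower-right : ∀ {t} → t < x → t ∈ R → t ≤ a + N t × a + N t + 2 ≤ top t
  tower-right {t} t<x t∈R with ∈-∃++ t∈R
  ... | M , Q , refl = lower , upper
    where
    open ≤-Reasoning
    lower : t ≤ a + N t
    lower = begin
        t
      ≡⟨ entry≡suc-countBelow I (∈-++⁺ʳ L (there (there t∈R))) ⟩
        suc (countBelow t ω)
      ≡⟨ cong suc (trans (countBelow-++ t L (x ∷ y ∷ R)) (cong (countBelow t L +_) (countBelow-xy t<x))) ⟩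
        suc (countBelow t L + N t)
      ≤⟨ s≤s (+-monoˡ-≤ (N t) (countBelow≤length t L)) ⟩
        a + N t ∎
    N-split : N t ≡ countBelow t M + countBelow t Q
    N-split = trans (countBelow-++ t M (t ∷ Q))
                    (cong (λ z → countBelow t M + (z + countBelow t Q)) (indicator-no (t <? t) (<-irrefl refl)))
    rearrange : ∀ l m q → suc l + (m + q) + 2 ≡ suc (l + suc (suc m)) + q
    rearrange = solve-∀
    upper : a + N t + 2 ≤ top t
    upper = begin
        a + N t + 2
      ≡⟨ cong (λ z → a + z + 2) N-split ⟩
        a + (countBelow t M + countBelow t Q) + 2
      ≤⟨ +-monoˡ-≤ 2 (+-monoʳ-≤ a (+-monoˡ-≤ (countBelow t Q) (countBelow≤length t M))) ⟩
        a + (length M + countBelow t Q) + 2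
      ≡⟨ rearrange (length L) (length M) (countBelow t Q) ⟩
        suc (length L + length (x ∷ y ∷ M)) + countBelow t Q
      ≡⟨ cong (λ z → suc z + countBelow t Q) (sym (length-++ L)) ⟩
        suc (length (L ++ x ∷ y ∷ M)) + countBelow t Q
      ≡⟨ sym (top-diagonal (L ++ x ∷ y ∷ M) t Q I (sym (++-assoc L (x ∷ y ∷ M) (t ∷ Q)))) ⟩
        top t ∎

  -- … while a smaller tower left of x ends below the diagonal a + N t - 1.
  tower-left : ∀ {t} → t < x → t ∈ L → suc (top t) ≤ a + N t
  tower-left {t} t<x t∈L with ∈-∃++ t∈L
  ... | L₁ , L₂ , refl = begin
      suc (top t)
    ≡⟨ cong suc (top-diagonal L₁ t (L₂ ++ x ∷ y ∷ R) I (++-assoc L₁ (t ∷ L₂) (x ∷ y ∷ R))) ⟩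
      suc (suc (length L₁) + countBelow t (L₂ ++ x ∷ y ∷ R))
    ≡⟨ cong (λ z → suc (suc (length L₁) + z))
            (trans (countBelow-++ t L₂ (x ∷ y ∷ R)) (cong (countBelow t L₂ +_) (countBelow-xy t<x))) ⟩
      suc (suc (length L₁) + (countBelow t L₂ + N t))
    ≤⟨ s≤s (+-monoʳ-≤ (suc (length L₁)) (+-monoˡ-≤ (N t) (countBelow≤length t L₂))) ⟩
      suc (suc (length L₁) + (length L₂ + N t))
    ≡⟨ rearrange (length L₁) (length L₂) (N t) ⟩
      suc (length L₁ + length (t ∷ L₂)) + N t
    ≡⟨ cong (λ z → suc z + N t) (sym (length-++ L₁)) ⟩
      a + N t ∎
    where
    open ≤-Reasoning
    rearrange : ∀ l m q → suc (suc l + (m + q)) ≡ suc (l + suc m) + q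
    rearrange = solve-∀

  -- The sliding cell passes over the towers of L and stops at the first tower
  -- that is x or lies in R.
  record Scan (p : ℕ) : Set where
    field
      t : ℕ
      p≤t : p ≤ t
      kind : t ≡ x ⊎ (t < x × t ∈ R)
      N≡ : N t ≡ N p
      skipped : ∀ {s} → p ≤ s → s < t → s ∈ L × s < x × N s ≡ N p

  below : ∀ {p k} → p + suc k ≡ x → p < x
  below {p} e = subst (p <_) e (m<m+n p z<s)

  scan : ∀ k p → 1 ≤ p → p + k ≡ x → Scan p
  scan zero p _ e = record
    { t = p ; p≤t = ≤-refl ; kind = inj₁ (trans (sym (+-identityʳ p)) e) ; N≡ = refl
    ; skipped = λ p≤s s<p → ⊥-elim (<-irrefl refl (≤-<-trans p≤s s<p)) }
  scan (suc k) p 1≤p e with ∈-++⁻ L (complete I p 1≤p (≤-trans (<⇒≤ (below e)) (proj₂ (bounds I x x∈ω))))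
  ... | inj₂ (here refl) = ⊥-elim (<-irrefl refl (below e))
  ... | inj₂ (there (here refl)) = ⊥-elim (<-asym (below e) x<y)
  ... | inj₂ (there (there p∈R)) = record
    { t = p ; p≤t = ≤-refl ; kind = inj₂ (below e , p∈R) ; N≡ = refl
    ; skipped = λ p≤s s<p → ⊥-elim (<-irrefl refl (≤-<-trans p≤s s<p)) }
  ... | inj₁ p∈L = record
    { t = Scan.t S ; p≤t = ≤-trans (n≤1+n p) (Scan.p≤t S) ; kind = Scan.kind S
    ; N≡ = trans (Scan.N≡ S) (N-suc-∈L p∈L) ; skipped = skipped }
    where
    S : Scan (suc p)
    S = scan k (suc p) (s≤s z≤n) (trans (sym (+-suc p k)) e)
    skipped : ∀ {s} → p ≤ s → s < Scan.t S → s ∈ L × s < x × N s ≡ N p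
    skipped {s} p≤s s<t with m≤n⇒m<n∨m≡n p≤s
    ... | inj₂ refl = p∈L , below e , refl
    ... | inj₁ p<s with Scan.skipped S p<s s<t
    ... | s∈L , s<x , N≡ = s∈L , s<x , trans N≡ (N-suc-∈L p∈L)

  scan-clear : ∀ {p a'} → a' ≡ a + N p → (S : Scan p) → NoCellOnPrevDiagBetween D p (Scan.t S) a'
  scan-clear {p} {a'} ea S s j sj∈ p≤s s<t eq with Scan.skipped S p≤s s<t | cell-out sj∈
  ... | s∈L , s<x , N≡ | _ , below-top = <-irrefl eq (begin-strict
      suc (s + j)   <⟨ s≤s below-top ⟩
      suc (top s)   ≤⟨ tower-left s<x s∈L ⟩
      a + N s       ≡⟨ cong (a +_) N≡ ⟩
      a + N p       ≡⟨ sym ea ⟩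
      a'            ∎)
    where open ≤-Reasoning

  slide-from : ∀ {a' p c} → Slide D a' p c → 1 ≤ p → p ≤ x → a' ≡ a + N p → c ≡ (x , height ω x)

  slide-at-x : ∀ {a' p c} → p ≤ x → a' ≡ a + N x → NoCellOnPrevDiagBetween D p x a' →
               Slide D a' p c → c ≡ (x , height ω x)
  slide-at-x {a'} {p} {c} p≤x ea clear = at-height (height ω x) refl
    where
    x+h≡a' : x + height ω x ≡ a'
    x+h≡a' = trans top-x (sym ea)
    at-height : ∀ k → height ω x ≡ k → Slide D a' p c → c ≡ (x , k)
    at-height zero h≡0 sl = empty sl
      where
      x≡a' : x ≡ a'
      x≡a' = trans (sym (+-identityʳ x)) (trans (cong (x +_) (sym h≡0)) x+h≡a')
      empty : Slide D a' p c → c ≡ (x , 0)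
      empty (s1a _ _) = cong (_, 0) (sym x≡a')
      empty (s1c _ a0∈ _ _) with cell-out a0∈
      ... | _ , below-top = ⊥-elim (<-irrefl refl (subst (λ h → a' + 0 < a' + h) h≡0
                                (subst (λ z → a' + 0 < a' + height ω z) (sym x≡a') below-top)))
      empty (s2a lm _) = ⊥-elim (leftmost-absent (≤-reflexive (sym x≡a')) clear lm)
      empty (s2c lm _ _ _) = ⊥-elim (leftmost-absent (≤-reflexive (sym x≡a')) clear lm)
    at-height (suc k) h≡ sl = topmost sl
      where
      x+k≡a' : suc (x + k) ≡ a'
      x+k≡a' = trans (sym (+-suc x k)) (trans (cong (x +_) (sym h≡)) x+h≡a')
      top-cell : (x , k) ∈ D
      top-cell = cell-in x∈ω (subst (λ h → x + k < x + h) (sym h≡) (+-monoʳ-< x ≤-refl))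
      topmost : Slide D a' p c → c ≡ (x , suc k)
      topmost (s1a noPrev _) = ⊥-elim (noPrev x k top-cell p≤x x+k≡a')
      topmost (s1c noPrev _ _ _) = ⊥-elim (noPrev x k top-cell p≤x x+k≡a')
      topmost (s2a lm _) with leftmost-unique lm top-cell p≤x x+k≡a' clear
      ... | refl , refl = refl
      topmost (s2c lm above∈ _ _) with leftmost-unique lm top-cell p≤x x+k≡a' clear
      ... | refl , refl = ⊥-elim (<-irrefl (cong (x +_) (sym h≡)) (proj₂ (cell-out above∈)))

  slide-past : ∀ {a' p c t} → p ≤ t → t < x → t ∈ R → a' ≡ a + N t →
               NoCellOnPrevDiagBetween D p t a' → Slide D a' p c → c ≡ (x , height ω x)
  slide-past {a'} {p} {c} {t} p≤t t<x t∈R ea clear = past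
    where
    t≤a' : t ≤ a'
    t≤a' = subst (t ≤_) (sym ea) (proj₁ (tower-right t<x t∈R))
    low-cell : ∀ {j} → t + j ≤ a' → (t , j) ∈ D
    low-cell {j} le = cell-in (∈-++⁺ʳ L (there (there t∈R))) (begin-strict
        t + j          ≤⟨ le ⟩
        a'             <⟨ ≤-trans (n≤1+n (suc a')) (≤-reflexive (+-comm 2 a')) ⟩
        a' + 2         ≡⟨ cong (_+ 2) ea ⟩
        a + N t + 2    ≤⟨ proj₂ (tower-right t<x t∈R) ⟩
        top t          ∎)
      where open ≤-Reasoning
    diagonal : t < a' → suc (t + (a' ∸ suc t)) ≡ a'
    diagonal = m+[n∸m]≡n
    next : suc a' ≡ a + N (suc t)
    next = trans (cong suc ea) (trans (sym (+-suc a (N t))) (cong (a +_) (sym (N-suc-∈R t∈R))))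
    prev-cell : (t<a' : t < a') → (t , a' ∸ suc t) ∈ D
    prev-cell t<a' = low-cell (<⇒≤ (≤-reflexive (diagonal t<a')))
    past : Slide D a' p c → c ≡ (x , height ω x)
    past (s1a _ noDiag) =
      ⊥-elim (noDiag t (a' ∸ t) (low-cell (≤-reflexive (m+[n∸m]≡n t≤a'))) p≤t (m+[n∸m]≡n t≤a'))
    past (s1c noPrev _ _ rec) with m≤n⇒m<n∨m≡n t≤a'
    ... | inj₁ t<a' = ⊥-elim (noPrev t _ (prev-cell t<a') p≤t (diagonal t<a'))
    ... | inj₂ refl = slide-from rec (s≤s z≤n) t<x next
    past (s2a lm notIn) with m≤n⇒m<n∨m≡n t≤a'
    ... | inj₂ t≡a' = ⊥-elim (leftmost-absent (≤-reflexive (sym t≡a')) clear lm)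
    ... | inj₁ t<a' with leftmost-unique lm (prev-cell t<a') p≤t (diagonal t<a') clear
    ... | refl , refl = ⊥-elim (notIn (low-cell (≤-reflexive (trans (+-suc t _) (diagonal t<a')))))
    past (s2c lm _ _ rec) with m≤n⇒m<n∨m≡n t≤a'
    ... | inj₂ t≡a' = ⊥-elim (leftmost-absent (≤-reflexive (sym t≡a')) clear lm)
    ... | inj₁ t<a' with leftmost-unique lm (prev-cell t<a') p≤t (diagonal t<a') clear
    ... | refl , refl = slide-from rec (s≤s z≤n) t<x next

  slide-from {a'} {p} {c} sl 1≤p p≤x ea = stop (Scan.kind S)
    where
    S : Scan p
    S = scan (x ∸ p) p 1≤p (m+[n∸m]≡n p≤x)
    ea' : a' ≡ a + N (Scan.t S)
    ea' = trans ea (cong (a +_) (sym (Scan.N≡ S)))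
    clear : NoCellOnPrevDiagBetween D p (Scan.t S) a'
    clear = scan-clear ea S
    stop : Scan.t S ≡ x ⊎ (Scan.t S < x × Scan.t S ∈ R) → c ≡ (x , height ω x)
    stop (inj₁ t≡x) = slide-at-x p≤x (trans ea' (cong (λ z → a + N z) t≡x))
                                 (subst (λ z → NoCellOnPrevDiagBetween D p z a') t≡x clear) sl
    stop (inj₂ (t<x , t∈R)) = slide-past (Scan.p≤t S) t<x t∈R ea' clear sl

  slide-ascent : ∀ {c} → Slide D a 1 c → c ≡ (x , height ω x)
  slide-ascent sl = slide-from sl ≤-refl 1≤x (sym (trans (cong (a +_) N-1) (+-identityʳ a)))

  diagram-swap : DiagramOf (L ++ y ∷ x ∷ R) (D ++ [ (x , height ω x) ])
  diagram-swap (t , j) = mk⇔ to from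
    where
    swapped↭ : L ++ y ∷ x ∷ R ↭ ω
    swapped↭ = ++⁺ˡ L (swap y x ↭-refl)
    raised : height (L ++ y ∷ x ∷ R) x ≡ suc (height ω x)
    raised = height-swap-smaller L x y R x<y (nodup I)
    kept : ∀ {t} → t ≢ x → height (L ++ y ∷ x ∷ R) t ≡ height ω t
    kept = height-swap-other L x y R _ x<y
    to : (t , j) ∈ D ++ [ (x , height ω x) ] → InDiagram (L ++ y ∷ x ∷ R) (t , j)
    to m with ∈-++⁻ D m
    ... | inj₂ (here refl) = ∈-resp-↭ (↭-sym swapped↭) x∈ω , ≤-reflexive (sym raised)
    ... | inj₁ m' with Equivalence.to (D≈ω (t , j)) m' | t ≟ x
    ... | t∈ , j<h | yes refl = ∈-resp-↭ (↭-sym swapped↭) t∈ , ≤-trans j<h (≤-trans (n≤1+n _) (≤-reflexive (sym raised)))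
    ... | t∈ , j<h | no t≢x = ∈-resp-↭ (↭-sym swapped↭) t∈ , subst (j <_) (sym (kept t≢x)) j<h
    from : InDiagram (L ++ y ∷ x ∷ R) (t , j) → (t , j) ∈ D ++ [ (x , height ω x) ]
    from (t∈ , j<h) with t ≟ x
    ... | no t≢x = ∈-++⁺ˡ (Equivalence.from (D≈ω (t , j)) (∈-resp-↭ swapped↭ t∈ , subst (j <_) (kept t≢x) j<h))
    ... | yes refl with m≤n⇒m<n∨m≡n (s≤s⁻¹ (subst (j <_) raised j<h))
    ... | inj₁ j<h' = ∈-++⁺ˡ (Equivalence.from (D≈ω (t , j)) (∈-resp-↭ swapped↭ t∈ , j<h'))
    ... | inj₂ refl = ∈-++⁺ʳ D (here refl)

AscentWord : List ℕ → List ℕ → Set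
AscentWord w [] = ⊤
AscentWord w (a ∷ β) = (1 ≤ a × entryAt w a < entryAt w (suc a)) × AscentWord (swapPos a w) β

-- (larger , smaller) entry exchanged by each letter of an ascent word
swappedPairs : List ℕ → List ℕ → List (ℕ × ℕ)
swappedPairs w [] = []
swappedPairs w (a ∷ β) = (entryAt w (suc a) , entryAt w a) ∷ swappedPairs (swapPos a w) β

slideWord-towers : ∀ {n} w β D E → IsPermutation n w → DiagramOf w D →
                   AscentWord w β → SlideWord D β E →
                   map proj₁ E ≡ map proj₁ D ++ map proj₂ (swappedPairs w β)
slideWord-towers w [] D .D _ _ _ done = sym (++-identityʳ _)
slideWord-towers w (a ∷ β) D E I D≈w ((1≤a , asc) , ascs) (step {c = c} sl rest)
  with ascentSplit? a w 1≤a asc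
... | ascentSplit L x y R refl refl e₃ e₄ e₅ = begin
    map proj₁ E
  ≡⟨ slideWord-towers _ β (D ++ [ c ]) E I' D'≈ ascs rest ⟩
    map proj₁ (D ++ [ c ]) ++ later
  ≡⟨ cong (_++ later) (map-++ proj₁ D [ c ]) ⟩
    (map proj₁ D ++ [ proj₁ c ]) ++ later
  ≡⟨ ++-assoc (map proj₁ D) [ proj₁ c ] later ⟩
    map proj₁ D ++ proj₁ c ∷ later
  ≡⟨ cong (λ z → map proj₁ D ++ z ∷ later) (trans (cong proj₁ c≡) (sym e₃)) ⟩
    map proj₁ D ++ entryAt (L ++ x ∷ y ∷ R) a ∷ later ∎
  where
  open ≡-Reasoning
  open SlideAscent L x y R (subst₂ _<_ e₃ e₄ asc) I D D≈w using (slide-ascent; diagram-swap)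
  later = map proj₂ (swappedPairs (swapPos a (L ++ x ∷ y ∷ R)) β)
  c≡ : c ≡ (x , height (L ++ x ∷ y ∷ R) x)
  c≡ = slide-ascent sl
  I' : IsPermutation _ (swapPos a (L ++ x ∷ y ∷ R))
  I' = IsPermutation-↭ (swapPos-↭ a _) I
  D'≈ : DiagramOf (swapPos a (L ++ x ∷ y ∷ R)) (D ++ [ c ])
  D'≈ = subst₂ DiagramOf (sym e₅) (cong (λ c → D ++ [ c ]) (sym c≡)) diagram-swap

length-filter-< : ∀ t w → length (filter (_<? t) w) ≡ countBelow t w
length-filter-< t [] = refl
length-filter-< t (v ∷ w) with v <? t
... | yes v<t = trans (cong length (filter-accept (_<? t) v<t)) (cong suc (length-filter-< t w))
... | no v≮t = trans (cong length (filter-reject (_<? t) v≮t)) (length-filter-< t w)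

inversions-∷ : ∀ v w → inversions (v ∷ w) ≡ countBelow v w + inversions w
inversions-∷ v w = cong (_+ inversions w) (length-filter-< v w)

inversions-swap-head : ∀ x y xs →
  inversions (y ∷ x ∷ xs) + indicator (y <? x) ≡ inversions (x ∷ y ∷ xs) + indicator (x <? y)
inversions-swap-head x y xs = begin
    inversions (y ∷ x ∷ xs) + indicator (y <? x)
  ≡⟨ cong (_+ indicator (y <? x)) (inversions-∷∷ y x xs) ⟩
    indicator (x <? y) + countBelow y xs + (countBelow x xs + inversions xs) + indicator (y <? x)
  ≡⟨ rearrange (indicator (x <? y)) (indicator (y <? x)) (countBelow y xs) (countBelow x xs) (inversions xs) ⟩
    indicator (y <? x) + countBelow x xs + (countBelow y xs + inversions xs) + indicator (x <? y)
  ≡⟨ sym (cong (_+ indicator (x <? y)) (inversions-∷∷ x y xs)) ⟩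
    inversions (x ∷ y ∷ xs) + indicator (x <? y) ∎
  where
  open ≡-Reasoning
  inversions-∷∷ : ∀ u v vs → inversions (u ∷ v ∷ vs) ≡ countBelow u (v ∷ vs) + (countBelow v vs + inversions vs)
  inversions-∷∷ u v vs = trans (inversions-∷ u (v ∷ vs)) (cong (countBelow u (v ∷ vs) +_) (inversions-∷ v vs))
  rearrange : ∀ i j b c r → i + b + (c + r) + j ≡ j + c + (b + r) + i
  rearrange = solve-∀

inversions-swapPos : ∀ a w → inversions (swapPos a w) ≤ inversions w ⊎
  (1 ≤ a × entryAt w a < entryAt w (suc a) × inversions (swapPos a w) ≡ suc (inversions w))
inversions-swapPos (suc zero) (x ∷ y ∷ xs) with x <? y
... | yes x<y = inj₂ (s≤s z≤n , x<y , (begin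
    inversions (y ∷ x ∷ xs)
  ≡⟨ sym (+-identityʳ (inversions (y ∷ x ∷ xs))) ⟩
    inversions (y ∷ x ∷ xs) + 0
  ≡⟨ cong (inversions (y ∷ x ∷ xs) +_) (sym (indicator-no (y <? x) (<-asym x<y))) ⟩
    inversions (y ∷ x ∷ xs) + indicator (y <? x)
  ≡⟨ inversions-swap-head x y xs ⟩
    inversions (x ∷ y ∷ xs) + indicator (x <? y)
  ≡⟨ cong (inversions (x ∷ y ∷ xs) +_) (indicator-yes (x <? y) x<y) ⟩
    inversions (x ∷ y ∷ xs) + 1
  ≡⟨ +-comm (inversions (x ∷ y ∷ xs)) 1 ⟩
    suc (inversions (x ∷ y ∷ xs)) ∎))
  where open ≡-Reasoning
... | no x≮y = inj₁ (begin
    inversions (y ∷ x ∷ xs)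
  ≤⟨ m≤m+n (inversions (y ∷ x ∷ xs)) (indicator (y <? x)) ⟩
    inversions (y ∷ x ∷ xs) + indicator (y <? x)
  ≡⟨ inversions-swap-head x y xs ⟩
    inversions (x ∷ y ∷ xs) + indicator (x <? y)
  ≡⟨ cong (inversions (x ∷ y ∷ xs) +_) (indicator-no (x <? y) x≮y) ⟩
    inversions (x ∷ y ∷ xs) + 0
  ≡⟨ +-identityʳ (inversions (x ∷ y ∷ xs)) ⟩
    inversions (x ∷ y ∷ xs) ∎)
  where open ≤-Reasoning
inversions-swapPos (suc (suc k)) (x ∷ xs) with inversions-swapPos (suc k) xs
... | inj₁ le = inj₁ (begin
    inversions (x ∷ swapPos (suc k) xs)
  ≡⟨ inversions-∷ x (swapPos (suc k) xs) ⟩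
    countBelow x (swapPos (suc k) xs) + inversions (swapPos (suc k) xs)
  ≤⟨ +-mono-≤ (≤-reflexive (countBelow-↭ x (swapPos-↭ (suc k) xs))) le ⟩
    countBelow x xs + inversions xs
  ≡⟨ sym (inversions-∷ x xs) ⟩
    inversions (x ∷ xs) ∎)
  where open ≤-Reasoning
... | inj₂ (_ , asc , e) = inj₂ (s≤s z≤n , asc , (begin
    inversions (x ∷ swapPos (suc k) xs)
  ≡⟨ inversions-∷ x (swapPos (suc k) xs) ⟩
    countBelow x (swapPos (suc k) xs) + inversions (swapPos (suc k) xs)
  ≡⟨ cong₂ _+_ (countBelow-↭ x (swapPos-↭ (suc k) xs)) e ⟩
    countBelow x xs + suc (inversions xs)
  ≡⟨ +-suc _ _ ⟩
    suc (countBelow x xs + inversions xs)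
  ≡⟨ cong suc (sym (inversions-∷ x xs)) ⟩
    suc (inversions (x ∷ xs)) ∎))
  where open ≡-Reasoning
inversions-swapPos zero w = inj₁ ≤-refl
inversions-swapPos (suc zero) [] = inj₁ ≤-refl
inversions-swapPos (suc zero) (x ∷ []) = inj₁ ≤-refl
inversions-swapPos (suc (suc k)) [] = inj₁ ≤-refl

inversions-applySwaps-≤ : ∀ w β → inversions (applySwaps w β) ≤ inversions w + length β
inversions-applySwaps-≤ w [] = ≤-reflexive (sym (+-identityʳ _))
inversions-applySwaps-≤ w (a ∷ β) with inversions-swapPos a w
... | inj₁ le = ≤-trans (inversions-applySwaps-≤ (swapPos a w) β)
                        (≤-trans (+-monoˡ-≤ (length β) le) (+-monoʳ-≤ (inversions w) (n≤1+n _)))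
... | inj₂ (_ , _ , e) = ≤-trans (inversions-applySwaps-≤ (swapPos a w) β)
                                 (≤-reflexive (trans (cong (_+ length β) e) (sym (+-suc _ _))))

-- Each letter changes the number of inversions by at most one, and only an
-- ascent raises it.
ascentWord-of-length : ∀ w β → inversions (applySwaps w β) ≡ inversions w + length β → AscentWord w β
ascentWord-of-length w [] _ = tt
ascentWord-of-length w (a ∷ β) eq with inversions-swapPos a w
... | inj₁ le = ⊥-elim (<-irrefl refl (begin-strict
    inversions w + length β
  <⟨ n<1+n _ ⟩
    suc (inversions w + length β)
  ≡⟨ sym (trans eq (+-suc _ _)) ⟩
    inversions (applySwaps (swapPos a w) β)
  ≤⟨ inversions-applySwaps-≤ (swapPos a w) β ⟩
    inversions (swapPos a w) + length β
  ≤⟨ +-monoˡ-≤ (length β) le ⟩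
    inversions w + length β ∎))
  where open ≤-Reasoning
... | inj₂ (1≤a , asc , e) =
  (1≤a , asc) , ascentWord-of-length (swapPos a w) β (trans eq (trans (+-suc _ _) (sym (cong (_+ length β) e))))

inversions-map-suc : ∀ w → inversions (map suc w) ≡ inversions w
inversions-map-suc [] = refl
inversions-map-suc (v ∷ w) =
  trans (inversions-∷ (suc v) (map suc w))
        (trans (cong₂ _+_ (countBelow-map-suc v w) (inversions-map-suc w)) (sym (inversions-∷ v w)))

inversions-idPerm : ∀ n → inversions (idPerm n) ≡ 0
inversions-idPerm zero = refl
inversions-idPerm (suc n) = begin
    inversions (idPerm (suc n))
  ≡⟨ cong inversions (idPerm-suc n) ⟩
    inversions (1 ∷ map suc (idPerm n))
  ≡⟨ inversions-∷ 1 (map suc (idPerm n)) ⟩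
    countBelow 1 (map suc (idPerm n)) + inversions (map suc (idPerm n))
  ≡⟨ cong₂ _+_ (trans (countBelow-map-suc 0 (idPerm n)) (countBelow-zero (idPerm n)))
               (trans (inversions-map-suc (idPerm n)) (inversions-idPerm n)) ⟩
    0 ∎
  where open ≡-Reasoning

reducedWord-ascentWord : ∀ {n ω α} → ReducedWord n ω α → AscentWord (idPerm n) α
reducedWord-ascentWord {n} {α = α} (_ , refl , len) =
  ascentWord-of-length (idPerm n) α (trans (sym len) (sym (cong (_+ length α) (inversions-idPerm n))))

-- 1-based position of the first occurrence of u in w; 0 if u does not occur
position : List ℕ → ℕ → ℕ
position [] u = 0
position (v ∷ w) u with v ≟ u
... | yes _ = 1
... | no _ = suc (position w u)

position-head : ∀ u w → position (u ∷ w) u ≡ 1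
position-head u w with u ≟ u
... | yes _ = refl
... | no u≢u = ⊥-elim (u≢u refl)

position-cons-≢ : ∀ u v w → v ≢ u → position (v ∷ w) u ≡ suc (position w u)
position-cons-≢ u v w v≢u with v ≟ u
... | yes v≡u = ⊥-elim (v≢u v≡u)
... | no _ = refl

position-≥1 : ∀ u w → u ∈ w → 1 ≤ position w u
position-≥1 u (v ∷ w) _ with v ≟ u
... | yes _ = ≤-refl
... | no _ = s≤s z≤n

position-injective : ∀ {u v} w → u ∈ w → v ∈ w → position w u ≡ position w v → u ≡ v
position-injective {u} {v} (h ∷ w) u∈ v∈ e with h ≟ u | h ≟ v
... | yes refl | yes refl = refl
... | yes refl | no h≢v = ⊥-elim (<-irrefl (suc-injective e) (position-≥1 v w (tail (h≢v ∘ sym) v∈)))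
... | no h≢u | yes refl =
  ⊥-elim (<-irrefl (sym (suc-injective e)) (position-≥1 u w (tail (h≢u ∘ sym) u∈)))
... | no h≢u | no h≢v =
  position-injective w (tail (h≢u ∘ sym) u∈) (tail (h≢v ∘ sym) v∈) (suc-injective e)

position-++-∉ : ∀ u L M → u ∉ L → position (L ++ M) u ≡ length L + position M u
position-++-∉ u [] M _ = refl
position-++-∉ u (v ∷ L) M u∉ with v ≟ u
... | yes e = ⊥-elim (u∉ (here (sym e)))
... | no _ = cong suc (position-++-∉ u L M (u∉ ∘ there))

position-split : ∀ L x y R → Nodup (L ++ x ∷ y ∷ R) →
                 position (L ++ x ∷ y ∷ R) x ≡ suc (length L) ×
                 position (L ++ x ∷ y ∷ R) y ≡ suc (suc (length L))
position-split L x y R nd = at-x , at-y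
  where
  x≢y : x ≢ y
  x≢y x≡y = proj₁ (Nodup-++⁻ʳ L (x ∷ y ∷ R) nd) (here x≡y)
  at-x : position (L ++ x ∷ y ∷ R) x ≡ suc (length L)
  at-x = trans (position-++-∉ x L _ (Nodup-++-∉ˡ L x (y ∷ R) nd))
               (trans (cong (length L +_) (position-head x (y ∷ R))) (+-comm (length L) 1))
  at-y : position (L ++ x ∷ y ∷ R) y ≡ suc (suc (length L))
  at-y = trans (position-++-∉ y L _ (λ y∈L → Nodup-++-disjoint L (x ∷ y ∷ R) y nd y∈L (there (here refl))))
               (trans (cong (length L +_) (trans (position-cons-≢ y x (y ∷ R) x≢y) (cong suc (position-head y R))))
                      (+-comm (length L) 2))

transpose : ℕ → ℕ → ℕ
transpose zero zero = 1
transpose zero (suc zero) = 0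
transpose zero (suc (suc i)) = suc (suc i)
transpose (suc a) zero = zero
transpose (suc a) (suc i) = suc (transpose a i)

transpose-< : ∀ a {i j} → i < j → ¬ (i ≡ a × j ≡ suc a) → transpose a i < transpose a j
transpose-< zero {zero} {suc zero} _ not-a = ⊥-elim (not-a (refl , refl))
transpose-< zero {zero} {suc (suc j)} _ _ = s≤s (s≤s z≤n)
transpose-< zero {suc zero} {suc (suc j)} _ _ = s≤s z≤n
transpose-< zero {suc (suc i)} {suc (suc j)} i<j _ = i<j
transpose-< zero {suc zero} {suc zero} (s≤s ())
transpose-< zero {suc (suc i)} {suc zero} (s≤s ())
transpose-< (suc a) {zero} {suc j} _ _ = s≤s z≤n
transpose-< (suc a) {suc i} {suc j} (s≤s i<j) not-a =
  s≤s (transpose-< a i<j (λ { (refl , refl) → not-a (refl , refl) }))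

position-swap : ∀ L x y R u → x ≢ y → u ∈ L ++ x ∷ y ∷ R →
                position (L ++ y ∷ x ∷ R) u ≡ transpose (suc (length L)) (position (L ++ x ∷ y ∷ R) u)
position-swap [] x y R u x≢y u∈ with u ≟ x | u ≟ y
... | yes refl | yes refl = ⊥-elim (x≢y refl)
... | yes refl | no _ = trans (position-cons-≢ x y (x ∷ R) (x≢y ∘ sym))
                              (trans (cong suc (position-head x R)) (cong (transpose 1) (sym (position-head x (y ∷ R)))))
... | no _ | yes refl = trans (position-head y (x ∷ R))
                              (cong (transpose 1) (sym (trans (position-cons-≢ y x (y ∷ R) x≢y) (cong suc (position-head y R)))))
... | no u≢x | no u≢y = begin
    position (y ∷ x ∷ R) u
  ≡⟨ position-cons-≢ u y (x ∷ R) y≢u ⟩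
    suc (position (x ∷ R) u)
  ≡⟨ cong suc (position-cons-≢ u x R x≢u) ⟩
    suc (suc (position R u))
  ≡⟨ sym (transpose-fixes (position-≥1 u R (tail (y≢u ∘ sym) (tail (x≢u ∘ sym) u∈)))) ⟩
    transpose 1 (suc (suc (position R u)))
  ≡⟨ cong (λ z → transpose 1 (suc z)) (sym (position-cons-≢ u y R y≢u)) ⟩
    transpose 1 (suc (position (y ∷ R) u))
  ≡⟨ cong (transpose 1) (sym (position-cons-≢ u x (y ∷ R) x≢u)) ⟩
    transpose 1 (position (x ∷ y ∷ R) u) ∎
  where
  open ≡-Reasoning
  x≢u = u≢x ∘ sym
  y≢u = u≢y ∘ sym
  transpose-fixes : ∀ {k} → 1 ≤ k → transpose 1 (suc (suc k)) ≡ suc (suc k)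
  transpose-fixes (s≤s z≤n) = refl
position-swap (v ∷ L) x y R u x≢y u∈ with v ≟ u
... | yes _ = refl
... | no v≢u = cong suc (position-swap L x y R u x≢y (tail (v≢u ∘ sym) u∈))

Inversion : List ℕ → ℕ × ℕ → Set
Inversion w (u , v) = u ∈ w × v ∈ w × v < u × position w u < position w v

module SwapInversions (L : List ℕ) (x y : ℕ) (R : List ℕ) (x<y : x < y) (nd : Nodup (L ++ x ∷ y ∷ R)) where

  w w' : List ℕ
  w = L ++ x ∷ y ∷ R
  w' = L ++ y ∷ x ∷ R

  a : ℕ
  a = suc (length L)

  swapped↭ : w' ↭ w
  swapped↭ = ++⁺ˡ L (swap y x ↭-refl)

  nd' : Nodup w'
  nd' = Nodup-↭ (↭-sym swapped↭) nd

  x≢y : x ≢ y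
  x≢y = <⇒≢ x<y

  inversion-kept : ∀ {u v} → Inversion w (u , v) → Inversion w' (u , v)
  inversion-kept {u} {v} (u∈ , v∈ , v<u , before) =
    ∈-resp-↭ (↭-sym swapped↭) u∈ , ∈-resp-↭ (↭-sym swapped↭) v∈ , v<u ,
    subst₂ _<_ (sym (position-swap L x y R u x≢y u∈)) (sym (position-swap L x y R v x≢y v∈))
           (transpose-< a before not-xy)
    where
    not-xy : ¬ (position w u ≡ a × position w v ≡ suc a)
    not-xy (at-a , at-suc-a) with position-split L x y R nd
    ... | at-x , at-y with position-injective w u∈ (∈-++⁺ʳ L (here refl)) (trans at-a (sym at-x))
                         | position-injective w v∈ (∈-++⁺ʳ L (there (here refl))) (trans at-suc-a (sym at-y))
    ... | refl | refl = <-asym v<u x<y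

  inversion-unswapped : ∀ {u v} → Inversion w' (u , v) → ¬ (position w' u ≡ a × position w' v ≡ suc a) →
                        Inversion w (u , v)
  inversion-unswapped {u} {v} (u∈' , v∈' , v<u , before) not-yx =
    ∈-resp-↭ swapped↭ u∈' , ∈-resp-↭ swapped↭ v∈' , v<u ,
    subst₂ _<_ (sym (position-swap L y x R u (x≢y ∘ sym) u∈')) (sym (position-swap L y x R v (x≢y ∘ sym) v∈'))
           (transpose-< a before not-yx)

  inversion-back : ∀ {u v} → Inversion w' (u , v) → Inversion w (u , v) ⊎ (u , v) ≡ (y , x)
  inversion-back {u} {v} inv@(u∈' , v∈' , _ , _)
    with position w' u ≟ a | position w' v ≟ suc a | position-split L y x R nd'
  ... | yes at-a | yes at-suc-a | at-y , at-x =
    inj₂ (cong₂ _,_ (position-injective w' u∈' (∈-++⁺ʳ L (here refl)) (trans at-a (sym at-y)))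
                    (position-injective w' v∈' (∈-++⁺ʳ L (there (here refl))) (trans at-suc-a (sym at-x))))
  ... | no not-a | _ | _ = inj₁ (inversion-unswapped inv (not-a ∘ proj₁))
  ... | yes _ | no not-suc-a | _ = inj₁ (inversion-unswapped inv (not-suc-a ∘ proj₂))

  inversion-new : Inversion w' (y , x)
  inversion-new with position-split L y x R nd'
  ... | at-y , at-x = ∈-++⁺ʳ L (here refl) , ∈-++⁺ʳ L (there (here refl)) , x<y ,
                      subst₂ _<_ (sym at-y) (sym at-x) ≤-refl

inversions-applySwaps : ∀ w β → Nodup w → AscentWord w β → ∀ {u v} →
  Inversion (applySwaps w β) (u , v) ⇔ (Inversion w (u , v) ⊎ (u , v) ∈ swappedPairs w β)
inversions-applySwaps w [] _ _ = mk⇔ inj₁ λ { (inj₁ inv) → inv ; (inj₂ ()) }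
inversions-applySwaps w (a ∷ β) nd ((1≤a , asc) , ascs) {u} {v} with ascentSplit? a w 1≤a asc
... | ascentSplit L x y R refl refl e₃ e₄ e₅ = mk⇔ to from
  where
  open SwapInversions L x y R (subst₂ _<_ e₃ e₄ asc) nd
    using (nd'; inversion-kept; inversion-back; inversion-new)
  IH = inversions-applySwaps _ β (subst Nodup (sym e₅) nd') ascs {u} {v}
  swapped : ∀ {q} → Inversion (swapPos a (L ++ x ∷ y ∷ R)) q ≡ Inversion (L ++ y ∷ x ∷ R) q
  swapped {q} = cong (λ z → Inversion z q) e₅
  exchanged : (entryAt (L ++ x ∷ y ∷ R) (suc a) , entryAt (L ++ x ∷ y ∷ R) a) ≡ (y , x)
  exchanged = cong₂ _,_ e₄ e₃
  to : Inversion (applySwaps _ β) (u , v) →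
       Inversion (L ++ x ∷ y ∷ R) (u , v) ⊎ (u , v) ∈ swappedPairs _ (a ∷ β)
  to inv with Equivalence.to IH inv
  ... | inj₂ m = inj₂ (there m)
  ... | inj₁ inv' with inversion-back (subst id swapped inv')
  ... | inj₁ inv₀ = inj₁ inv₀
  ... | inj₂ uv≡yx = inj₂ (here (trans uv≡yx (sym exchanged)))
  from : Inversion (L ++ x ∷ y ∷ R) (u , v) ⊎ (u , v) ∈ swappedPairs _ (a ∷ β) →
         Inversion (applySwaps _ β) (u , v)
  from (inj₁ inv₀) = Equivalence.from IH (inj₁ (subst id (sym swapped) (inversion-kept inv₀)))
  from (inj₂ (here uv≡)) =
    Equivalence.from IH
      (inj₁ (subst id (sym swapped) (subst (Inversion _) (sym (trans uv≡ exchanged)) inversion-new)))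
  from (inj₂ (there m)) = Equivalence.from IH (inj₂ m)

position-map-suc : ∀ w t → position (map suc w) (suc t) ≡ position w t
position-map-suc [] t = refl
position-map-suc (v ∷ w) t with suc v ≟ suc t | v ≟ t
... | yes _ | yes _ = refl
... | yes e | no ne = ⊥-elim (ne (suc-injective e))
... | no ne | yes e = ⊥-elim (ne (cong suc e))
... | no _ | no _ = cong suc (position-map-suc w t)

position-idPerm : ∀ n t → t ∈ idPerm n → position (idPerm n) t ≡ t
position-idPerm zero t ()
position-idPerm (suc n) t = subst (λ w → t ∈ w → position w t ≡ t) (sym (idPerm-suc n)) go
  where
  go : t ∈ 1 ∷ map suc (idPerm n) → position (1 ∷ map suc (idPerm n)) t ≡ t
  go (here refl) = position-head 1 (map suc (idPerm n))
  go (there m) with ∈-map⁻ suc m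
  ... | u , u∈ , refl =
    trans (position-cons-≢ (suc u) 1 (map suc (idPerm n))
                           (λ e → idPerm-∌0 n (subst (_∈ idPerm n) (sym (suc-injective e)) u∈)))
          (cong suc (trans (position-map-suc (idPerm n) u) (position-idPerm n u u∈)))

idPerm-noInversion : ∀ n {u v} → ¬ Inversion (idPerm n) (u , v)
idPerm-noInversion n (u∈ , v∈ , v<u , before) =
  <-asym v<u (subst₂ _<_ (position-idPerm n _ u∈) (position-idPerm n _ v∈) before)

inversion⇔swappedPair : ∀ {n ω α} → ReducedWord n ω α → ∀ {u v} →
                        Inversion ω (u , v) ⇔ (u , v) ∈ swappedPairs (idPerm n) α
inversion⇔swappedPair {n} {α = α} red@(_ , refl , _) =
  mk⇔ (λ inv → [ ⊥-elim ∘ idPerm-noInversion n , id ]′ (Equivalence.to pairs inv))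
      (Equivalence.from pairs ∘ inj₂)
  where
  pairs = inversions-applySwaps (idPerm n) α (nodup (idPerm-isPermutation n)) (reducedWord-ascentWord red)

AscentWord-++ : ∀ w γ δ → AscentWord w γ → AscentWord (applySwaps w γ) δ → AscentWord w (γ ++ δ)
AscentWord-++ w [] δ _ ascs = ascs
AscentWord-++ w (a ∷ γ) δ (asc , ascs) ascs' = asc , AscentWord-++ (swapPos a w) γ δ ascs ascs'

swappedPairs-++ : ∀ w γ δ → swappedPairs w (γ ++ δ) ≡ swappedPairs w γ ++ swappedPairs (applySwaps w γ) δ
swappedPairs-++ w [] δ = refl
swappedPairs-++ w (a ∷ γ) δ = cong (_ ∷_) (swappedPairs-++ (swapPos a w) γ δ)

entryAt-map-split : ∀ (f : ℕ → ℕ) L u v R →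
  entryAt (map f (L ++ u ∷ v ∷ R)) (suc (length L)) ≡ f u ×
  entryAt (map f (L ++ u ∷ v ∷ R)) (suc (suc (length L))) ≡ f v
entryAt-map-split f L u v R rewrite map-++ f L (u ∷ v ∷ R) | sym (length-map f L) =
  entryAt-++ˡ (map f L) (f u) (f v) (map f R) , entryAt-++ʳ (map f L) (f u) (f v) (map f R)

-- Read backwards, the word undoes its swaps; after relabelling by f each
-- exchanged pair (u , v) becomes the ascent f u < f v.
reverse-ascentWord : ∀ (f : ℕ → ℕ) w β → AscentWord w β →
  (∀ {u v} → (u , v) ∈ swappedPairs w β → f u < f v) →
  AscentWord (map f (applySwaps w β)) (reverse β) ×
  map proj₂ (swappedPairs (map f (applySwaps w β)) (reverse β)) ≡
    reverse (map (f ∘ proj₁) (swappedPairs w β))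
reverse-ascentWord f w [] _ _ = tt , refl
reverse-ascentWord f w (a ∷ β) ((1≤a , asc) , ascs) reversing with ascentSplit? a w 1≤a asc
... | ascentSplit L x y R refl refl e₃ e₄ e₅ = ascent , pairs
  where
  w₁ = swapPos a (L ++ x ∷ y ∷ R)
  W = map f (applySwaps w₁ β)
  IH = reverse-ascentWord f w₁ β ascs (reversing ∘ there)
  undone : applySwaps W (reverse β) ≡ map f w₁
  undone = trans (applySwaps-map f (applySwaps w₁ β) (reverse β)) (cong (map f) (applySwaps-reverse w₁ β))
  at-a : entryAt (map f w₁) a ≡ f y
  at-a = trans (cong (λ z → entryAt (map f z) a) e₅) (proj₁ (entryAt-map-split f L y x R))
  at-suc-a : entryAt (map f w₁) (suc a) ≡ f x
  at-suc-a = trans (cong (λ z → entryAt (map f z) (suc a)) e₅) (proj₂ (entryAt-map-split f L y x R))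
  fy<fx : f y < f x
  fy<fx = subst₂ (λ p q → f p < f q) e₄ e₃ (reversing (here refl))
  ascent : AscentWord W (reverse (a ∷ β))
  ascent = subst (AscentWord W) (sym (unfold-reverse a β))
    (AscentWord-++ W (reverse β) [ a ] (proj₁ IH)
      (subst (λ z → AscentWord z [ a ]) (sym undone) ((1≤a , subst₂ _<_ (sym at-a) (sym at-suc-a) fy<fx) , tt)))
  pairs : map proj₂ (swappedPairs W (reverse (a ∷ β))) ≡ reverse (map (f ∘ proj₁) (swappedPairs _ (a ∷ β)))
  pairs = begin
      map proj₂ (swappedPairs W (reverse (a ∷ β)))
    ≡⟨ cong (map proj₂ ∘ swappedPairs W) (unfold-reverse a β) ⟩
      map proj₂ (swappedPairs W (reverse β ++ [ a ]))
    ≡⟨ cong (map proj₂) (swappedPairs-++ W (reverse β) [ a ]) ⟩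
      map proj₂ (swappedPairs W (reverse β) ++ swappedPairs (applySwaps W (reverse β)) [ a ])
    ≡⟨ map-++ proj₂ (swappedPairs W (reverse β)) _ ⟩
      map proj₂ (swappedPairs W (reverse β)) ++ map proj₂ (swappedPairs (applySwaps W (reverse β)) [ a ])
    ≡⟨ cong₂ _++_ (proj₂ IH) (cong (λ z → [ entryAt z a ]) undone) ⟩
      reverse (map (f ∘ proj₁) (swappedPairs w₁ β)) ++ [ entryAt (map f w₁) a ]
    ≡⟨ cong (λ z → reverse (map (f ∘ proj₁) (swappedPairs w₁ β)) ++ [ z ]) (trans at-a (cong f (sym e₄))) ⟩
      reverse (map (f ∘ proj₁) (swappedPairs w₁ β)) ++ [ f (entryAt (L ++ x ∷ y ∷ R) (suc a)) ]
    ≡⟨ sym (unfold-reverse _ (map (f ∘ proj₁) (swappedPairs w₁ β))) ⟩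
      reverse (map (f ∘ proj₁) (swappedPairs (L ++ x ∷ y ∷ R) (a ∷ β))) ∎
    where open ≡-Reasoning

position-lookup : ∀ w (i : Fin (length w)) → Nodup w → position w (lookup w i) ≡ suc (toℕ i)
position-lookup (v ∷ w) fzero _ = position-head v w
position-lookup (v ∷ w) (fsuc i) (v∉ , nd) =
  trans (position-cons-≢ (lookup w i) v w (λ e → v∉ (subst (_∈ w) (sym e) (∈-lookup i))))
        (cong suc (position-lookup w i nd))

map-position-self : ∀ w → Nodup w → map (position w) w ≡ idPerm (length w)
map-position-self [] _ = refl
map-position-self (v ∷ w) (v∉ , nd) = begin
    position (v ∷ w) v ∷ map (position (v ∷ w)) w
  ≡⟨ cong₂ _∷_ (position-head v w) (map-cong-local (shifted w id)) ⟩
    1 ∷ map (suc ∘ position w) w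
  ≡⟨ cong (1 ∷_) (trans (map-∘ w) (cong (map suc) (map-position-self w nd))) ⟩
    1 ∷ map suc (idPerm (length w))
  ≡⟨ sym (idPerm-suc (length w)) ⟩
    idPerm (length (v ∷ w)) ∎
  where
  open ≡-Reasoning
  shifted : ∀ us → (∀ {u} → u ∈ us → u ∈ w) → All (λ u → position (v ∷ w) u ≡ suc (position w u)) us
  shifted [] _ = []
  shifted (u ∷ us) sub = position-cons-≢ u v w (λ e → v∉ (subst (_∈ w) (sym e) (sub (here refl))))
                         ∷ shifted us (sub ∘ there)

diagram-idPerm : ∀ n → DiagramOf (idPerm n) []
diagram-idPerm n (t , j) =
  mk⇔ (λ ()) λ (t∈ , j<h) → ⊥-elim (n≮0 (subst (j <_) (height-idPerm n t t∈) j<h))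

rotheCell : List ℕ → ℕ × ℕ → Cell
rotheCell ω (u , v) = (position ω u , v)

InversionCell : List ℕ → Cell → Set
InversionCell ω c = ∃₂ λ u v → Inversion ω (u , v) × c ≡ rotheCell ω (u , v)

zip-map-proj₂ : ∀ (g : ℕ × ℕ → ℕ) P → zip (map g P) (map proj₂ P) ≡ map (λ q → (g q , proj₂ q)) P
zip-map-proj₂ g [] = refl
zip-map-proj₂ g (q ∷ P) = cong (_ ∷_) (zip-map-proj₂ g P)

rothification-cells : ∀ {n ω α T T'} → ReducedWord n ω α →
                      StdTowerTableau α T → StdTowerTableau (reverse α) T' →
                      rothification T T' ≡ map (rotheCell ω) (swappedPairs (idPerm n) α)
rothification-cells {n} {ω} {α} {T} {T'} red@(_ , refl , _) st st' = begin
    zip (map towerIndex (reverse T')) (map towerIndex T)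
  ≡⟨ cong₂ zip rows columns ⟩
    zip (map (position ω ∘ proj₁) P) (map proj₂ P)
  ≡⟨ zip-map-proj₂ (position ω ∘ proj₁) P ⟩
    map (rotheCell ω) P ∎
  where
  open ≡-Reasoning
  P = swappedPairs (idPerm n) α
  I = idPerm-isPermutation n
  asc = reducedWord-ascentWord red
  columns : map proj₁ T ≡ map proj₂ P
  columns = slideWord-towers (idPerm n) α [] T I (diagram-idPerm n) asc st
  Iω = IsPermutation-applySwaps (idPerm n) α I
  relabel : map (position ω) ω ≡ idPerm n
  relabel = trans (map-position-self ω (nodup Iω)) (cong idPerm (size Iω))
  reversed = reverse-ascentWord (position ω) (idPerm n) α asc
               (λ m → proj₂ (proj₂ (proj₂ (Equivalence.from (inversion⇔swappedPair red) m))))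
  rows : map proj₁ (reverse T') ≡ map (position ω ∘ proj₁) P
  rows = begin
      map proj₁ (reverse T')
    ≡⟨ reverse-map proj₁ T' ⟩
      reverse (map proj₁ T')
    ≡⟨ cong reverse (slideWord-towers (idPerm n) (reverse α) [] T' I (diagram-idPerm n)
                      (subst (λ z → AscentWord z (reverse α)) relabel (proj₁ reversed)) st') ⟩
      reverse (map proj₂ (swappedPairs (idPerm n) (reverse α)))
    ≡⟨ cong reverse (subst (λ z → map proj₂ (swappedPairs z (reverse α)) ≡ reverse (map (position ω ∘ proj₁) P))
                           relabel (proj₂ reversed)) ⟩
      reverse (reverse (map (position ω ∘ proj₁) P))
    ≡⟨ reverse-involutive _ ⟩
      map (position ω ∘ proj₁) P ∎

inversion⇔InRothe : ∀ {ω c} → Nodup ω → InversionCell ω c ⇔ InRothe ω c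
inversion⇔InRothe {ω} {c} nd = mk⇔ to from
  where
  position-index : ∀ {u} (u∈ : u ∈ ω) → position ω u ≡ suc (toℕ (index u∈))
  position-index u∈ = trans (cong (position ω) (lookup-index u∈)) (position-lookup ω (index u∈) nd)
  to : InversionCell ω c → InRothe ω c
  to (u , v , (u∈ , v∈ , v<u , before) , refl) =
    index u∈ , index v∈ , s≤s⁻¹ (subst₂ _<_ (position-index u∈) (position-index v∈) before) ,
    subst₂ _<_ (lookup-index v∈) (lookup-index u∈) v<u , position-index u∈ , lookup-index v∈
  from : InRothe ω c → InversionCell ω c
  from (i , j , i<j , ωj<ωi , refl , refl) =
    lookup ω i , lookup ω j ,
    (∈-lookup i , ∈-lookup j , ωj<ωi ,
     subst₂ _<_ (sym (position-lookup ω i nd)) (sym (position-lookup ω j nd)) (s≤s i<j)) ,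
    cong (_, lookup ω j) (sym (position-lookup ω i nd))

∈-rotheCells⇔inversion : ∀ {n ω α c} → ReducedWord n ω α →
  c ∈ map (rotheCell ω) (swappedPairs (idPerm n) α) ⇔ InversionCell ω c
∈-rotheCells⇔inversion {n} {ω} {α} {c} red = mk⇔ to from
  where
  to : c ∈ map (rotheCell ω) (swappedPairs (idPerm n) α) → InversionCell ω c
  to m with ∈-map⁻ (rotheCell ω) m
  ... | (u , v) , uv∈ , c≡ = u , v , Equivalence.from (inversion⇔swappedPair red) uv∈ , c≡
  from : InversionCell ω c → c ∈ map (rotheCell ω) (swappedPairs (idPerm n) α)
  from (u , v , inv , refl) = ∈-map⁺ (rotheCell ω) (Equivalence.to (inversion⇔swappedPair red) inv)

mainTheorem3 : (n : ℕ) (ω α : List ℕ) (T T' : List Cell) →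
               ReducedWord n ω α →
               StdTowerTableau α T →
               StdTowerTableau (reverse α) T' →
               (c : ℕ × ℕ) → (c ∈ rothification T T') ⇔ InRothe ω c
mainTheorem3 n ω α T T' red st st' c =
  subst (λ D → c ∈ D ⇔ InRothe ω c) (sym (rothification-cells red st st'))
        (⇔-trans (∈-rotheCells⇔inversion red) (inversion⇔InRothe (nodup ω-isPermutation)))
  where
  ω-isPermutation : IsPermutation n ω
  ω-isPermutation = subst (IsPermutation n) (sym (proj₁ (proj₂ red)))
                          (IsPermutation-applySwaps (idPerm n) α (idPerm-isPermutation n))
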